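{- Let $n$ be even, $f(x)=x^{2^n-2}$ on $\mathbb{F}_{2^n}$, and $A:\mathbb{F}_{2^n}\to\mathbb{F}_{2^n}$ an affine function. Then $|\mathcal{G}_f\cap\mathcal{G}_A|\leq\sqrt{2}\cdot2^{n/2}+\frac32$.
   Context: The graph of $g$ is $\mathcal{G}_g=\{(x,g(x)) : x\in\mathbb{F}_{2^n}\}$. An affine function is an $\mathbb{F}_2$-linear map plus a constant. -}

module Defs where

open import Level using (Level; suc; _⊔_)
open import Data.Nat using (ℕ; zero; suc; _^_)
open import Data.Fin using (Fin)
import Data.Fin.Properties as FinP
open import Data.List using (List; length; filter)
open import Data.List.Base using ()
open import Data.Fin.Base using ()
open import Data.List using () renaming (map to lmap)
open import Data.Vec.Functional using ()
open import Data.Product using (_×_)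
open import Relation.Nullary using (¬_; Dec; yes; no)
open import Relation.Binary.PropositionalEquality
open import Relation.Binary.Definitions using (DecidableEquality)
open import Function.Bundles using (_↔_; Inverse)
open import Algebra.Structures using (IsCommutativeRing)
import Data.List as L
import Data.Fin as F

-- A finite field with exactly 2^n elements (unique up to isomorphism: F_{2^n}),
-- with propositional equality as its equality.
record GF2^ (n : ℕ) : Set₁ where
  infixl 7 _*_
  infixl 6 _+_
  field
    Carrier : Set
    _+_ _*_ : Carrier → Carrier → Carrier
    -_      : Carrier → Carrier
    0# 1#   : Carrier
    isCommutativeRing : IsCommutativeRing _≡_ _+_ _*_ -_ 0# 1#
    1≢0     : ¬ (1# ≡ 0#)
    _⁻¹     : Carrier → Carrier
    inverse : ∀ x → ¬ (x ≡ 0#) → x * (x ⁻¹) ≡ 1#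
    enum    : Fin (2 ^ n) ↔ Carrier

  _≟_ : DecidableEquality Carrier
  x ≟ y with Inverse.from enum x F.≟ Inverse.from enum y
  ... | yes p = yes (trans (sym (Inverse.strictlyInverseˡ enum x))
                     (trans (cong (Inverse.to enum) p) (Inverse.strictlyInverseˡ enum y)))
  ... | no ¬p = no (λ e → ¬p (cong (Inverse.from enum) e))

  elements : List Carrier
  elements = L.map (Inverse.to enum) (L.allFin (2 ^ n))

  pow : Carrier → ℕ → Carrier
  pow x zero    = 1#
  pow x (suc k) = x * pow x k

  -- F_2-linear maps: additive maps (scalars are only 0 and 1)
  IsF₂Linear : (Carrier → Carrier) → Set
  IsF₂Linear L = (∀ x y → L (x + y) ≡ L x + L y) × (L 0# ≡ 0#)

  IsAffine : (Carrier → Carrier) → Set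
  IsAffine A = Data.Product.∃ λ L → Data.Product.∃ λ c → IsF₂Linear L × (∀ x → A x ≡ L x + c)

  graphIntersection : (Carrier → Carrier) → (Carrier → Carrier) → ℕ
  graphIntersection g h = length (filter (λ x → g x ≟ h x) elements)

{-# OPTIONS --safe #-}

-- Let q = 2 ^ n. By Fermat's little theorem x ^ (q - 2) is the inverse of x ≠ 0, so a nonzero common
-- point of the two graphs is a solution of x · A x = 1. Write A = L + c with L additive. If x and x - d
-- are both solutions then L d · x (x - d) = - d, so for d ≠ 0 the product x (x - d) is determined by d
-- and x is one of the two roots of a quadratic: every nonzero difference is realised by at most two
-- ordered pairs of solutions. Sorting the s² ordered pairs of solutions by their difference gives
-- s² ≤ s + 2 (q - 1). With the point x = 0 the graphs share c ≤ s + 1 points, and then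
-- (2c - 3)² ≤ (2s - 1)² ≤ 8q - 7.

module Submission where

open import Level using (Level)
open import Algebra.Bundles using (CommutativeMonoid; CommutativeRing; AbelianGroup)
open import Algebra.Core using (Op₁; Op₂)
open import Algebra.Structures using (IsAbelianGroup)
open import Data.Empty using (⊥-elim)
open import Data.Fin as Fin using (Fin; zero; suc; punchIn)
open import Data.Fin.Properties using (punchInᵢ≢i; any?; injective⇒≤)
open import Data.List as List using (length; filter; tabulate; allFin)
open import Data.List.Properties using (map-tabulate)
open import Data.Nat as ℕ using (ℕ; zero; suc; _≤_; z≤n; s≤s; _∸_; _^_)
open import Data.Nat.Properties as ℕₚ using (+-*-semiring)
open import Data.Nat.Tactic.RingSolver using (solve-∀)
open import Data.Product using (_×_; _,_; proj₁)
open import Data.Sum using (_⊎_; inj₁; inj₂; [_,_]′)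
open import Data.Vec.Functional using (Vector; removeAt)
open import Function using (_∘_; _↔_; Inverse; mk↔ₛ′)
open import Function.Construct.Composition using (_↔-∘_)
open import Function.Construct.Symmetry using (↔-sym)
open import Relation.Nullary using (¬_; Dec; yes; no; _×-dec_; map′)
open import Relation.Unary using (Pred; Decidable)
open import Relation.Binary.Definitions using (DecidableEquality)
open import Relation.Binary.PropositionalEquality
  using (_≡_; _≢_; refl; sym; trans; cong; cong₂; subst; subst₂; module ≡-Reasoning)
open import Defs

private
  variable
    p p₁ p₂ : Level
    P : Set p
    Q : Set p₁
    R : Set p₂

indicator : Dec P → ℕ
indicator (yes _) = 1
indicator (no _)  = 0

indicator-yes : P → (P? : Dec P) → indicator P? ≡ 1
indicator-yes _ (yes _) = refl
indicator-yes p (no ¬p) = ⊥-elim (¬p p)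

indicator-no : ¬ P → (P? : Dec P) → indicator P? ≡ 0
indicator-no ¬p (yes p) = ⊥-elim (¬p p)
indicator-no _  (no _)  = refl

indicator-cong : (P → Q) → (Q → P) → (P? : Dec P) (Q? : Dec Q) → indicator P? ≡ indicator Q?
indicator-cong P→Q Q→P (yes p) Q? = sym (indicator-yes (P→Q p) Q?)
indicator-cong P→Q Q→P (no ¬p) Q? = sym (indicator-no (¬p ∘ Q→P) Q?)

indicator-× : (P? : Dec P) (Q? : Dec Q) → indicator (P? ×-dec Q?) ≡ indicator P? ℕ.* indicator Q?
indicator-× (yes _) (yes _) = refl
indicator-× (yes _) (no _)  = refl
indicator-× (no _)  _       = refl

indicator-⊎ : (P → Q ⊎ R) → (P? : Dec P) (Q? : Dec Q) (R? : Dec R) →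
              indicator P? ≤ indicator Q? ℕ.+ indicator R?
indicator-⊎ P→Q⊎R (no _)  Q? R? = z≤n
indicator-⊎ P→Q⊎R (yes p) Q? R? with P→Q⊎R p
... | inj₁ q = subst (λ k → 1 ≤ k ℕ.+ indicator R?) (sym (indicator-yes q Q?)) (s≤s z≤n)
... | inj₂ r = subst (λ k → 1 ≤ indicator Q? ℕ.+ k) (sym (indicator-yes r R?)) (ℕₚ.m≤n+m 1 (indicator Q?))

module FiniteSum {c ℓ} (M : CommutativeMonoid c ℓ) {X : Set} {q : ℕ} (enum : Fin q ↔ X) where

  open CommutativeMonoid M using (Carrier; _≈_; _∙_; ε; ∙-congˡ; identityʳ; setoid)
    renaming (trans to ≈-trans; reflexive to ≈-reflexive)
  open import Algebra.Properties.CommutativeMonoid.Sum M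
  open Inverse enum using (to; from; strictlyInverseˡ; strictlyInverseʳ)

  ∑ₓ : (X → Carrier) → Carrier
  ∑ₓ f = sum (f ∘ to)

  ∑ₓ-reindex : (h : X ↔ X) (f : X → Carrier) → ∑ₓ f ≈ ∑ₓ (f ∘ Inverse.to h)
  ∑ₓ-reindex h f = ≈-trans (sum-permute (f ∘ to) (↔-sym enum ↔-∘ (h ↔-∘ enum)))
    (≈-reflexive (sum-cong-≗ (λ i → cong f (strictlyInverseˡ (Inverse.to h (to i))))))

  private
    sum-single : ∀ {k} (t : Vector Carrier k) (j : Fin k) → (∀ i → i ≢ j → t i ≈ ε) → sum t ≈ t j
    sum-single {suc k} t j t≈ε = begin
      sum t                      ≈⟨ sum-remove t ⟩
      t j ∙ sum (removeAt t j)   ≈⟨ ∙-congˡ (≈-trans (sum-cong-≋ (λ i → t≈ε (punchIn j i) (punchInᵢ≢i j i)))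
                                                    (sum-replicate-zero k)) ⟩
      t j ∙ ε                    ≈⟨ identityʳ (t j) ⟩
      t j                        ∎
      where open import Relation.Binary.Reasoning.Setoid setoid

  ∑ₓ-single : (u : X) (f : X → Carrier) → (∀ x → x ≢ u → f x ≈ ε) → ∑ₓ f ≈ f u
  ∑ₓ-single u f f≈ε = ≈-trans (sum-single (f ∘ to) (from u) (λ i i≢u → f≈ε (to i) (i≢u ∘ to≡u⇒≡from)))
                              (≈-reflexive (cong f (strictlyInverseˡ u)))
    where
    to≡u⇒≡from : ∀ {i} → to i ≡ u → i ≡ from u
    to≡u⇒≡from {i} e = trans (sym (strictlyInverseʳ i)) (cong from e)

module Counting {X : Set} {q : ℕ} (enum : Fin q ↔ X) where

  open import Data.Nat using (_+_; _*_)
  open Inverse enum using (to; from; strictlyInverseˡ)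
  open import Algebra.Properties.Semiring.Sum +-*-semiring using (sum; sum-cong-≗; ∑-distrib-+)
  open FiniteSum ℕₚ.+-0-commutativeMonoid enum public using (∑ₓ; ∑ₓ-reindex; ∑ₓ-single)

  from-injective : ∀ {x y} → from x ≡ from y → x ≡ y
  from-injective {x} {y} e = trans (sym (strictlyInverseˡ x)) (trans (cong to e) (strictlyInverseˡ y))

  _≟_ : DecidableEquality X
  x ≟ y = map′ from-injective (cong from) (from x Fin.≟ from y)

  count : {P : Pred X p} → Decidable P → ℕ
  count P? = ∑ₓ (indicator ∘ P?)

  private
    ∑-mono-≤ : ∀ {k} {f g : Vector ℕ k} → (∀ i → f i ≤ g i) → sum f ≤ sum g
    ∑-mono-≤ {zero}  f≤g = z≤n
    ∑-mono-≤ {suc k} f≤g = ℕₚ.+-mono-≤ (f≤g zero) (∑-mono-≤ (f≤g ∘ suc))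

    ∑-const : ∀ k c → sum {k} (λ _ → c) ≡ k * c
    ∑-const zero    c = refl
    ∑-const (suc k) c = cong (c +_) (∑-const k c)

  ∑ₓ-mono-≤ : {f g : X → ℕ} → (∀ x → f x ≤ g x) → ∑ₓ f ≤ ∑ₓ g
  ∑ₓ-mono-≤ f≤g = ∑-mono-≤ (f≤g ∘ to)

  ∑ₓ-const : ∀ c → ∑ₓ (λ _ → c) ≡ q * c
  ∑ₓ-const = ∑-const q

  count-cong : {P : Pred X p} {Q : Pred X p₁} (P? : Decidable P) (Q? : Decidable Q) →
               (∀ x → P x → Q x) → (∀ x → Q x → P x) → count P? ≡ count Q?
  count-cong P? Q? P⊆Q Q⊆P = sum-cong-≗ (λ i → indicator-cong (P⊆Q (to i)) (Q⊆P (to i)) (P? (to i)) (Q? (to i)))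

  count-⊎ : {P : Pred X p} {Q : Pred X p₁} {R : Pred X p₂} (P? : Decidable P) (Q? : Decidable Q) (R? : Decidable R) →
            (∀ x → P x → Q x ⊎ R x) → count P? ≤ count Q? + count R?
  count-⊎ P? Q? R? P⊆Q∪R =
    ℕₚ.≤-trans (∑ₓ-mono-≤ (λ x → indicator-⊎ (P⊆Q∪R x) (P? x) (Q? x) (R? x)))
               (ℕₚ.≤-reflexive (∑-distrib-+ (indicator ∘ Q? ∘ to) (indicator ∘ R? ∘ to)))

  count-≡ : (u : X) (≡u? : Decidable (_≡ u)) → count ≡u? ≡ 1
  count-≡ u ≡u? = trans (∑ₓ-single u (indicator ∘ ≡u?) (λ x x≢u → indicator-no x≢u (≡u? x)))
                        (indicator-yes refl (≡u? u))

  count-≤2 : {P : Pred X p} (P? : Decidable P) (w : X → X) →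
             (∀ {x y} → P x → P y → x ≡ y ⊎ x ≡ w y) → count P? ≤ 2
  count-≤2 P? w two-roots with any? (P? ∘ to)
  ... | yes (i , Py) = begin
    count P?                      ≤⟨ count-⊎ P? (_≟ y) (_≟ w y) (λ x Px → two-roots Px Py) ⟩
    count (_≟ y) + count (_≟ w y) ≡⟨ cong₂ _+_ (count-≡ y (_≟ y)) (count-≡ (w y) (_≟ w y)) ⟩
    2                             ∎
    where
    y : X
    y = to i
    open ℕₚ.≤-Reasoning
  ... | no ∄P = subst (_≤ 2) (sym count≡0) z≤n
    where
    count≡0 : count P? ≡ 0
    count≡0 = trans (sum-cong-≗ (λ i → indicator-no (∄P ∘ (i ,_)) (P? (to i))))
                    (trans (∑ₓ-const 0) (ℕₚ.*-zeroʳ q))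

  length-filter-tabulate : {P : Pred X p} (P? : Decidable P) {k : ℕ} (f : Fin k → X) →
                           length (filter P? (tabulate f)) ≡ sum (indicator ∘ P? ∘ f)
  length-filter-tabulate P? {zero}  f = refl
  length-filter-tabulate P? {suc k} f with P? (f zero)
  ... | yes _ = cong suc (length-filter-tabulate P? (f ∘ suc))
  ... | no _  = length-filter-tabulate P? (f ∘ suc)

  length-filter-enumeration : {P : Pred X p} (P? : Decidable P) →
                              length (filter P? (List.map to (allFin q))) ≡ count P?
  length-filter-enumeration P? = trans (cong (length ∘ filter P?) (map-tabulate (λ i → i) to))
                                       (length-filter-tabulate P? to)

module DifferenceCounting {X : Set} {_∙_ : Op₂ X} {ε : X} {_⁻¹ : Op₁ X}
  (isAbelianGroup : IsAbelianGroup _≡_ _∙_ ε _⁻¹) {q : ℕ} (enum : Fin q ↔ X) where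

  open import Data.Nat using (_+_; _*_)
  open Counting enum
  open Inverse enum using (to)
  open import Algebra.Properties.Semiring.Sum +-*-semiring
    using (sum-cong-≗; ∑-distrib-+; ∑-comm; *-distribˡ-sum; *-distribʳ-sum)

  group : AbelianGroup _ _
  group = record { isAbelianGroup = isAbelianGroup }

  open AbelianGroup group using (_-_; assoc; identityʳ)
  open import Algebra.Properties.AbelianGroup group using (⁻¹-anti-homo‿-; xyx⁻¹≈y; ε⁻¹≈ε)

  x-[x-y]≡y : ∀ x y → x - (x - y) ≡ y
  x-[x-y]≡y x y = begin
    x - (x - y)   ≡⟨ cong (x ∙_) (⁻¹-anti-homo‿- x y) ⟩
    x ∙ (y - x)   ≡⟨ sym (assoc x y (x ⁻¹)) ⟩
    (x ∙ y) - x   ≡⟨ xyx⁻¹≈y x y ⟩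
    y             ∎
    where open ≡-Reasoning

  x-ε≡x : ∀ x → x - ε ≡ x
  x-ε≡x x = trans (cong (x ∙_) ε⁻¹≈ε) (identityʳ x)

  difference-from : X → X ↔ X
  difference-from x = mk↔ₛ′ (λ y → x - y) (λ y → x - y) (x-[x-y]≡y x) (x-[x-y]≡y x)

  module _ {S : Pred X p} (S? : Decidable S) where

    private
      𝟙S : X → ℕ
      𝟙S = indicator ∘ S?

    pairs-with-difference : (d : X) → Decidable (λ x → S x × S (x - d))
    pairs-with-difference d x = S? x ×-dec S? (x - d)

    count-pairs : count S? * count S? ≡ ∑ₓ (λ d → count (pairs-with-difference d))
    count-pairs = begin
      count S? * count S?                     ≡⟨ *-distribʳ-sum (count S?) (𝟙S ∘ to) ⟩
      ∑ₓ (λ x → 𝟙S x * count S?)              ≡⟨ sum-cong-≗ (λ i → *-distribˡ-sum (𝟙S (to i)) (𝟙S ∘ to)) ⟩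
      ∑ₓ (λ x → ∑ₓ (λ y → 𝟙S x * 𝟙S y))       ≡⟨ sum-cong-≗ (λ i → ∑ₓ-reindex (difference-from (to i))
                                                                              (λ y → 𝟙S (to i) * 𝟙S y)) ⟩
      ∑ₓ (λ x → ∑ₓ (λ d → 𝟙S x * 𝟙S (x - d))) ≡⟨ ∑-comm (λ i j → 𝟙S (to i) * 𝟙S (to i - to j)) ⟩
      ∑ₓ (λ d → ∑ₓ (λ x → 𝟙S x * 𝟙S (x - d))) ≡⟨ sum-cong-≗ (λ j → sum-cong-≗ (λ i →
                                                   sym (indicator-× (S? (to i)) (S? (to i - to j))))) ⟩
      ∑ₓ (λ d → count (pairs-with-difference d)) ∎
      where open ≡-Reasoning

    -- s (s - 1) ≤ 2 (q - 1), with both subtractions moved to the other side.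
    pairs-≤2⇒count-bound : (∀ d → d ≢ ε → count (pairs-with-difference d) ≤ 2) →
                           count S? * count S? + 2 ≤ count S? + 2 * q
    pairs-≤2⇒count-bound pairs-≤2 = begin
      s * s + 2                          ≡⟨ cong₂ _+_ count-pairs (cong (2 *_) (sym (count-≡ ε (_≟ ε)))) ⟩
      ∑ₓ pairs + 2 * ∑ₓ δ                ≡⟨ cong (∑ₓ pairs +_) (*-distribˡ-sum 2 (δ ∘ to)) ⟩
      ∑ₓ pairs + ∑ₓ (λ d → 2 * δ d)      ≡⟨ ∑-distrib-+ (pairs ∘ to) (λ i → 2 * δ (to i)) ⟨
      ∑ₓ (λ d → pairs d + 2 * δ d)       ≤⟨ ∑ₓ-mono-≤ pointwise ⟩
      ∑ₓ (λ d → s * δ d + 2)             ≡⟨ ∑-distrib-+ (λ i → s * δ (to i)) (λ _ → 2) ⟩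
      ∑ₓ (λ d → s * δ d) + ∑ₓ (λ _ → 2)  ≡⟨ cong₂ _+_ (sym (*-distribˡ-sum s (δ ∘ to))) (∑ₓ-const 2) ⟩
      s * ∑ₓ δ + q * 2                   ≡⟨ cong₂ _+_ (trans (cong (s *_) (count-≡ ε (_≟ ε))) (ℕₚ.*-identityʳ s))
                                                      (ℕₚ.*-comm q 2) ⟩
      s + 2 * q                          ∎
      where
      open ℕₚ.≤-Reasoning
      s : ℕ
      s = count S?
      pairs : X → ℕ
      pairs d = count (pairs-with-difference d)
      δ : X → ℕ
      δ d = indicator (d ≟ ε)
      pairs-ε≡s : pairs ε ≡ s
      pairs-ε≡s = count-cong (pairs-with-difference ε) S? (λ _ → proj₁)
                             (λ x Sx → Sx , subst S (sym (x-ε≡x x)) Sx)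
      pointwise : ∀ d → pairs d + 2 * δ d ≤ s * δ d + 2
      pointwise d with d ≟ ε
      ... | yes refl rewrite pairs-ε≡s = ℕₚ.≤-reflexive (cong (_+ 2) (sym (ℕₚ.*-identityʳ s)))
      ... | no d≢ε rewrite ℕₚ.*-zeroʳ s | ℕₚ.+-identityʳ (pairs d) = pairs-≤2 d d≢ε

module FiniteField {n : ℕ} (K : GF2^ n) where

  open GF2^ K
  open Inverse enum using (to; from)
  open Counting enum using (from-injective)

  ring : CommutativeRing _ _
  ring = record { isCommutativeRing = isCommutativeRing }

  open CommutativeRing ring
    using (_-_; +-isAbelianGroup; +-abelianGroup; *-commutativeMonoid; commutativeSemiring;
           +-identityʳ; *-identityˡ; *-identityʳ; *-assoc; *-comm; zeroˡ; zeroʳ; -‿inverseʳ)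
  open import Algebra.Properties.AbelianGroup +-abelianGroup
    using (//-rightDividesˡ; //-rightDividesʳ; x∙y⁻¹≈ε⇒x≈y; ⁻¹-injective; ε⁻¹≈ε)
    renaming (∙-cancelˡ to +-cancelˡ)
  open import Algebra.Solver.Ring.NaturalCoefficients.Default commutativeSemiring
    using (solve; _:+_; _:*_; _:=_)
  open FiniteSum *-commutativeMonoid enum
    using () renaming (∑ₓ to ∏ₓ; ∑ₓ-reindex to ∏ₓ-reindex; ∑ₓ-single to ∏ₓ-single)
  open import Algebra.Properties.CommutativeMonoid.Sum *-commutativeMonoid
    using () renaming (sum to prod; ∑-distrib-+ to ∏-distrib-*; sum-cong-≗ to prod-cong-≗)
  open ≡-Reasoning

  q : ℕ
  q = 2 ^ n

  2≤q : 2 ≤ q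
  2≤q = injective⇒≤ {f = from ∘ zeroOrOne} (zeroOrOne-injective ∘ from-injective)
    where
    zeroOrOne : Fin 2 → Carrier
    zeroOrOne zero    = 0#
    zeroOrOne (suc _) = 1#
    zeroOrOne-injective : ∀ {i j} → zeroOrOne i ≡ zeroOrOne j → i ≡ j
    zeroOrOne-injective {zero}     {zero}     _ = refl
    zeroOrOne-injective {zero}     {suc zero} e = ⊥-elim (1≢0 (sym e))
    zeroOrOne-injective {suc zero} {zero}     e = ⊥-elim (1≢0 e)
    zeroOrOne-injective {suc zero} {suc zero} _ = refl

  x⁻¹[xy]≡y : ∀ {x} → x ≢ 0# → ∀ y → x ⁻¹ * (x * y) ≡ y
  x⁻¹[xy]≡y {x} x≢0 y = begin
    x ⁻¹ * (x * y)   ≡⟨ *-assoc _ _ _ ⟨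
    x ⁻¹ * x * y     ≡⟨ cong (_* y) (trans (*-comm _ _) (inverse x x≢0)) ⟩
    1# * y           ≡⟨ *-identityˡ y ⟩
    y                ∎

  x[x⁻¹y]≡y : ∀ {x} → x ≢ 0# → ∀ y → x * (x ⁻¹ * y) ≡ y
  x[x⁻¹y]≡y {x} x≢0 y = begin
    x * (x ⁻¹ * y)   ≡⟨ *-assoc _ _ _ ⟨
    x * x ⁻¹ * y     ≡⟨ cong (_* y) (inverse x x≢0) ⟩
    1# * y           ≡⟨ *-identityˡ y ⟩
    y                ∎

  *-cancelˡ : ∀ {x y z} → x ≢ 0# → x * y ≡ x * z → y ≡ z
  *-cancelˡ {x} {y} {z} x≢0 xy≡xz = begin
    y                ≡⟨ x⁻¹[xy]≡y x≢0 y ⟨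
    x ⁻¹ * (x * y)   ≡⟨ cong (x ⁻¹ *_) xy≡xz ⟩
    x ⁻¹ * (x * z)   ≡⟨ x⁻¹[xy]≡y x≢0 z ⟩
    z                ∎

  zero-product : ∀ {x y} → x * y ≡ 0# → x ≡ 0# ⊎ y ≡ 0#
  zero-product {x} {y} xy≡0 with x ≟ 0#
  ... | yes x≡0 = inj₁ x≡0
  ... | no x≢0  = inj₂ (*-cancelˡ x≢0 (trans xy≡0 (sym (zeroʳ x))))

  *-≢0 : ∀ {x y} → x ≢ 0# → y ≢ 0# → x * y ≢ 0#
  *-≢0 x≢0 y≢0 = [ x≢0 , y≢0 ]′ ∘ zero-product

  scaling : ∀ {x} → x ≢ 0# → Carrier ↔ Carrier
  scaling {x} x≢0 = mk↔ₛ′ (x *_) (x ⁻¹ *_) (x[x⁻¹y]≡y x≢0) (x⁻¹[xy]≡y x≢0)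

  prod-const : ∀ k x → prod {k} (λ _ → x) ≡ pow x k
  prod-const zero    x = refl
  prod-const (suc k) x = cong (x *_) (prod-const k x)

  prod-≢0 : ∀ {k} (t : Vector Carrier k) → (∀ i → t i ≢ 0#) → prod t ≢ 0#
  prod-≢0 {zero}  t t≢0 = 1≢0
  prod-≢0 {suc k} t t≢0 = *-≢0 (t≢0 zero) (prod-≢0 (t ∘ suc) (t≢0 ∘ suc))

  ifZero : Carrier → Carrier → Carrier → Carrier
  ifZero z u v with z ≟ 0#
  ... | yes _ = u
  ... | no _  = v

  ifZero-0 : ∀ u v → ifZero 0# u v ≡ u
  ifZero-0 u v with 0# ≟ 0#
  ... | yes _  = refl
  ... | no 0≢0 = ⊥-elim (0≢0 refl)

  ifZero-≢0 : ∀ {z} u v → z ≢ 0# → ifZero z u v ≡ v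
  ifZero-≢0 {z} u v z≢0 with z ≟ 0#
  ... | yes z≡0 = ⊥-elim (z≢0 z≡0)
  ... | no _    = refl

  ∏ifZero-x-1≡x : ∀ x → ∏ₓ (λ z → ifZero z x 1#) ≡ x
  ∏ifZero-x-1≡x x = trans (∏ₓ-single 0# (λ z → ifZero z x 1#) (λ z → ifZero-≢0 x 1#)) (ifZero-0 x 1#)

  -- Scaling z ↦ x * z permutes the field, so it leaves ∏ₓ unit, the product of the nonzero elements,
  -- unchanged; factor by factor it multiplies ∏ₓ unit by this product, which is x ^ (q - 1).
  ∏ifZero-1-x≡1 : ∀ {x} → x ≢ 0# → ∏ₓ (λ z → ifZero z 1# x) ≡ 1#
  ∏ifZero-1-x≡1 {x} x≢0 = *-cancelˡ (prod-≢0 (unit ∘ to) (unit-≢0 ∘ to)) (begin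
    ∏ₓ unit * ∏ₓ ρ            ≡⟨ *-comm _ _ ⟩
    ∏ₓ ρ * ∏ₓ unit            ≡⟨ ∏-distrib-* (ρ ∘ to) (unit ∘ to) ⟨
    ∏ₓ (λ z → ρ z * unit z)   ≡⟨ prod-cong-≗ (unit-scale ∘ to) ⟨
    ∏ₓ (λ z → unit (x * z))   ≡⟨ ∏ₓ-reindex (scaling x≢0) unit ⟨
    ∏ₓ unit                   ≡⟨ *-identityʳ _ ⟨
    ∏ₓ unit * 1#              ∎)
    where
    ρ unit : Carrier → Carrier
    ρ z    = ifZero z 1# x
    unit z = ifZero z 1# z
    unit-≢0 : ∀ z → unit z ≢ 0#
    unit-≢0 z with z ≟ 0#
    ... | yes _  = 1≢0
    ... | no z≢0 = z≢0
    unit-scale : ∀ z → unit (x * z) ≡ ρ z * unit z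
    unit-scale z with z ≟ 0#
    ... | yes z≡0 = begin
      unit (x * z)   ≡⟨ cong unit (trans (cong (x *_) z≡0) (zeroʳ x)) ⟩
      unit 0#        ≡⟨ ifZero-0 1# 0# ⟩
      1#             ≡⟨ *-identityˡ 1# ⟨
      1# * 1#        ∎
    ... | no z≢0 = ifZero-≢0 1# (x * z) (*-≢0 x≢0 z≢0)

  fermat : ∀ {x} → x ≢ 0# → pow x q ≡ x
  fermat {x} x≢0 = begin
    pow x q                                              ≡⟨ prod-const q x ⟨
    ∏ₓ (λ _ → x)                                         ≡⟨ prod-cong-≗ (split ∘ to) ⟨
    ∏ₓ (λ z → ρ z * ι z)                                 ≡⟨ ∏-distrib-* (ρ ∘ to) (ι ∘ to) ⟩
    ∏ₓ ρ * ∏ₓ ι                                          ≡⟨ cong₂ _*_ (∏ifZero-1-x≡1 x≢0) (∏ifZero-x-1≡x x) ⟩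
    1# * x                                               ≡⟨ *-identityˡ x ⟩
    x                                                    ∎
    where
    ρ ι : Carrier → Carrier
    ρ z = ifZero z 1# x
    ι z = ifZero z x 1#
    split : ∀ z → ρ z * ι z ≡ x
    split z with z ≟ 0#
    ... | yes _ = *-identityˡ x
    ... | no _  = *-identityʳ x

  x*x^[q∸2]≡1 : ∀ {x} → x ≢ 0# → x * pow x (q ∸ 2) ≡ 1#
  x*x^[q∸2]≡1 {x} x≢0 = *-cancelˡ x≢0 (begin
    x * (x * pow x (q ∸ 2))   ≡⟨ cong (pow x) (ℕₚ.m+[n∸m]≡n 2≤q) ⟩
    pow x q                   ≡⟨ fermat x≢0 ⟩
    x                         ≡⟨ *-identityʳ x ⟨
    x * 1#                    ∎)

  [x-y][x+y-d]≡0 : ∀ {x y d} → x * (x - d) ≡ y * (y - d) → (x - y) * ((x + y) - d) ≡ 0#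
  [x-y][x+y-d]≡0 {x} {y} {d} eq = begin
    (x - y) * ((x + y) - d)
      ≡⟨ solve 4 (λ x y ny nd → (x :+ ny) :* ((x :+ y) :+ nd)
                                 := x :* (x :+ nd) :+ ny :* (y :+ nd) :+ x :* (y :+ ny))
               refl x y (- y) (- d) ⟩
    x * (x - d) + - y * (y - d) + x * (y - y)
      ≡⟨ cong (λ t → t + - y * (y - d) + x * (y - y)) eq ⟩
    y * (y - d) + - y * (y - d) + x * (y - y)
      ≡⟨ solve 4 (λ x y ny nd → y :* (y :+ nd) :+ ny :* (y :+ nd) :+ x :* (y :+ ny)
                                 := (y :+ ny) :* (y :+ nd) :+ x :* (y :+ ny))
               refl x y (- y) (- d) ⟩
    (y - y) * (y - d) + x * (y - y)
      ≡⟨ cong (λ t → t * (y - d) + x * t) (-‿inverseʳ y) ⟩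
    0# * (y - d) + x * 0#
      ≡⟨ cong₂ _+_ (zeroˡ (y - d)) (zeroʳ x) ⟩
    0# + 0#
      ≡⟨ +-identityʳ 0# ⟩
    0# ∎

  x[x-d]≡y[y-d]⇒x≡y⊎x≡d-y : ∀ {x y d} → x * (x - d) ≡ y * (y - d) → x ≡ y ⊎ x ≡ d - y
  x[x-d]≡y[y-d]⇒x≡y⊎x≡d-y {x} {y} {d} eq with zero-product ([x-y][x+y-d]≡0 eq)
  ... | inj₁ x-y≡0   = inj₁ (x∙y⁻¹≈ε⇒x≈y x y x-y≡0)
  ... | inj₂ x+y-d≡0 = inj₂ (begin
    x             ≡⟨ //-rightDividesʳ y x ⟨
    (x + y) - y   ≡⟨ cong (_- y) (x∙y⁻¹≈ε⇒x≈y (x + y) d x+y-d≡0) ⟩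
    d - y         ∎)

  module Affine (A L : Carrier → Carrier) (c : Carrier)
    (L-additive : ∀ x y → L (x + y) ≡ L x + L y) (A≗L+c : ∀ x → A x ≡ L x + c) where

    open Counting enum using (count; count-⊎; count-≡; count-≤2; length-filter-enumeration)
    open DifferenceCounting +-isAbelianGroup enum using (pairs-with-difference; pairs-≤2⇒count-bound)

    Solution : Pred Carrier _
    Solution x = x * A x ≡ 1#

    solution? : Decidable Solution
    solution? x = (x * A x) ≟ 1#

    graph-point⇒solution⊎0 : ∀ {x} → pow x (q ∸ 2) ≡ A x → Solution x ⊎ x ≡ 0#
    graph-point⇒solution⊎0 {x} e with x ≟ 0#
    ... | yes x≡0 = inj₂ x≡0
    ... | no x≢0  = inj₁ (trans (cong (x *_) (sym e)) (x*x^[q∸2]≡1 x≢0))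

    A-shift : ∀ x d → A x ≡ A (x - d) + L d
    A-shift x d = begin
      A x                   ≡⟨ A≗L+c x ⟩
      L x + c               ≡⟨ cong (λ y → L y + c) (//-rightDividesˡ d x) ⟨
      L (x - d + d) + c     ≡⟨ cong (_+ c) (L-additive (x - d) d) ⟩
      L (x - d) + L d + c   ≡⟨ solve 3 (λ a b c → a :+ b :+ c := a :+ c :+ b) refl (L (x - d)) (L d) c ⟩
      L (x - d) + c + L d   ≡⟨ cong (_+ L d) (A≗L+c (x - d)) ⟨
      A (x - d) + L d       ∎

    L[d]x[x-d]≡-d : ∀ {x d} → Solution x → Solution (x - d) → L d * (x * (x - d)) ≡ - d
    L[d]x[x-d]≡-d {x} {d} Sx Sy = sym (+-cancelˡ x (- d) (L d * (x * y)) (begin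
      y                               ≡⟨ *-identityʳ y ⟨
      y * 1#                          ≡⟨ cong (y *_) Sx ⟨
      y * (x * A x)                   ≡⟨ cong (λ a → y * (x * a)) (A-shift x d) ⟩
      y * (x * (A y + L d))           ≡⟨ solve 4 (λ x y a l → y :* (x :* (a :+ l)) := x :* (y :* a) :+ l :* (x :* y))
                                               refl x y (A y) (L d) ⟩
      x * (y * A y) + L d * (x * y)   ≡⟨ cong (λ t → x * t + L d * (x * y)) Sy ⟩
      x * 1# + L d * (x * y)          ≡⟨ cong (_+ L d * (x * y)) (*-identityʳ x) ⟩
      x + L d * (x * y)               ∎))
      where
      y : Carrier
      y = x - d

    same-difference⇒x≡y⊎x≡d-y : ∀ {d x y} → d ≢ 0# → Solution x → Solution (x - d) →
                                Solution y → Solution (y - d) → x ≡ y ⊎ x ≡ d - y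
    same-difference⇒x≡y⊎x≡d-y {d} {x} {y} d≢0 Sx Sx-d Sy Sy-d =
      x[x-d]≡y[y-d]⇒x≡y⊎x≡d-y (*-cancelˡ Ld≢0 (trans (L[d]x[x-d]≡-d Sx Sx-d) (sym (L[d]x[x-d]≡-d Sy Sy-d))))
      where
      Ld≢0 : L d ≢ 0#
      Ld≢0 Ld≡0 = d≢0 (⁻¹-injective (begin
        - d                   ≡⟨ L[d]x[x-d]≡-d Sx Sx-d ⟨
        L d * (x * (x - d))   ≡⟨ cong (_* (x * (x - d))) Ld≡0 ⟩
        0# * (x * (x - d))    ≡⟨ zeroˡ _ ⟩
        0#                    ≡⟨ ε⁻¹≈ε ⟨
        - 0#                  ∎))

    pair-count-≤2 : ∀ d → d ≢ 0# → count (pairs-with-difference solution? d) ≤ 2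
    pair-count-≤2 d d≢0 = count-≤2 (pairs-with-difference solution? d) (λ y → d - y)
      (λ (Sx , Sx-d) (Sy , Sy-d) → same-difference⇒x≡y⊎x≡d-y d≢0 Sx Sx-d Sy Sy-d)

    graph-count≤solution-count+1 : graphIntersection (λ x → pow x (q ∸ 2)) A ≤ count solution? ℕ.+ 1
    graph-count≤solution-count+1 =
      subst₂ _≤_ (sym (length-filter-enumeration on-graph?)) (cong (count solution? ℕ.+_) (count-≡ 0# (_≟ 0#)))
        (count-⊎ on-graph? solution? (_≟ 0#) (λ x → graph-point⇒solution⊎0))
      where
      on-graph? : Decidable (λ x → pow x (q ∸ 2) ≡ A x)
      on-graph? x = pow x (q ∸ 2) ≟ A x

    solution-count-bound : count solution? ℕ.* count solution? ℕ.+ 2 ≤ count solution? ℕ.+ 2 ℕ.* q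
    solution-count-bound = pairs-≤2⇒count-bound solution? pair-count-≤2

open import Data.Nat using (_+_; _*_)

[1+2k]²≤8q : ∀ k q → suc k * suc k + 2 ≤ suc k + 2 * q → suc (2 * k) ^ 2 ≤ 8 * q
[1+2k]²≤8q k q hyp = ℕₚ.m+n≤o⇒m≤o _ (ℕₚ.+-cancelʳ-≤ (4 * suc k) _ _ 4×hyp)
  where
  4[s²+2]≡[1+2k]²+7+4s : ∀ k → 4 * (suc k * suc k + 2) ≡ (suc (2 * k) * (suc (2 * k) * 1) + 7) + 4 * suc k
  4[s²+2]≡[1+2k]²+7+4s = solve-∀
  4[s+2q]≡8q+4s : ∀ k q → 4 * (suc k + 2 * q) ≡ 8 * q + 4 * suc k
  4[s+2q]≡8q+4s = solve-∀
  4×hyp : (suc (2 * k) ^ 2 + 7) + 4 * suc k ≤ 8 * q + 4 * suc k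
  4×hyp = subst₂ _≤_ (4[s²+2]≡[1+2k]²+7+4s k) (4[s+2q]≡8q+4s k q) (ℕₚ.*-monoʳ-≤ 4 hyp)

[2c∸3]²≤8q : ∀ {c s q} → c ≤ s + 1 → s * s + 2 ≤ s + 2 * q → (2 * c ∸ 3) ^ 2 ≤ 8 * q
[2c∸3]²≤8q {c} {zero} c≤1 _ rewrite ℕₚ.m≤n⇒m∸n≡0 (ℕₚ.≤-trans (ℕₚ.*-monoʳ-≤ 2 c≤1) (ℕₚ.n≤1+n 2)) =
  z≤n
[2c∸3]²≤8q {c} {suc k} {q} c≤k+2 hyp = ℕₚ.≤-trans (ℕₚ.^-monoˡ-≤ 2 2c∸3≤1+2k) ([1+2k]²≤8q k q hyp)
  where
  2[k+2]≡3+[1+2k] : ∀ k → 2 * (suc k + 1) ≡ 3 + suc (2 * k)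
  2[k+2]≡3+[1+2k] = solve-∀
  2c∸3≤1+2k : 2 * c ∸ 3 ≤ suc (2 * k)
  2c∸3≤1+2k = subst (λ m → 2 * c ∸ 3 ≤ m ∸ 3) (2[k+2]≡3+[1+2k] k)
                    (ℕₚ.∸-monoˡ-≤ 3 (ℕₚ.*-monoʳ-≤ 2 c≤k+2))

lemma6 : (n m : ℕ) → n ≡ 2 * m → (K : GF2^ n) → (A : GF2^.Carrier K → GF2^.Carrier K) →
             GF2^.IsAffine K A →
             let c = GF2^.graphIntersection K (λ x → GF2^.pow K x (2 ^ n ∸ 2)) A
             in (2 * c ∸ 3) ^ 2 ≤ 8 * 2 ^ n
lemma6 n m _ K A (L , c , (L-additive , _) , A≗L+c) =
  [2c∸3]²≤8q {q = q} graph-count≤solution-count+1 solution-count-bound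
  where
  open FiniteField K
  open Affine A L c L-additive A≗L+c
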